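{- Let $(a_l)_{l\geq1}$ and $(b_l)_{l\geq1}$ be sequences of real numbers and let $n,k,r\geq0$ be integers. Then $$B^{(r)}_{n+r,k+r}(a_1,a_2,\ldots;b_1,b_2,\ldots)=\sum_{i=0}^{r}\sum_{j=0}^{k}\binom{r}{i}\binom{n}{j}b_1^{\,i}a_1^{\,j}\,B^{(r-i)}_{n-j+r-i,\,k-j+r-i}(0,a_2,a_3,\ldots;0,b_2,b_3,\ldots).$$
   Context: For sequences $a=(a_l)_{l\geq1}$, $b=(b_l)_{l\geq1}$ and integers $N,K,s\geq0$, the partial $s$-Bell polynomial is $$B^{(s)}_{N,K}(a_1,a_2,\ldots;b_1,b_2,\ldots)=\sum_{\pi}\ \prod_{B\in\pi,\ B\cap\{1,\ldots,s\}=\emptyset}a_{|B|}\prod_{B\in\pi,\ B\cap\{1,\ldots,s\}\neq\emptyset}b_{|B|},$$ where $\pi$ ranges over the partitions of $\{1,\ldots,N\}$ into exactly $K$ nonempty blocks such that $1,\ldots,s$ lie in pairwise distinct blocks (an empty sum is $0$; the empty partition of the empty set contributes $1$). Terms with $\binom{n}{j}=0$ are zero. -}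

module Defs where

open import Level using (Level)
open import Data.Bool using (Bool; true; false; if_then_else_; _∧_)
open import Data.Nat using (ℕ; zero; suc; _≤ᵇ_; _≡ᵇ_; _∸_)
open import Data.Nat.Combinatorics using (_C_)
open import Data.List using (List; []; _∷_; [_]; map; concatMap; length; foldr)
open import Relation.Nullary.Decidable using (does)
open import Relation.Unary using (Decidable)
open import Relation.Binary.PropositionalEquality using (_≡_)
open import Algebra.Bundles using (CommutativeRing)

-- A partition is a list of blocks; a block is a list of elements (labels 1..N).
-- Partitions of {1..N+1} arise from partitions of {1..N} by putting N+1
-- either into a new singleton block or into exactly one existing block.

insertEach : ℕ → List (List ℕ) → List (List (List ℕ))
insertEach x [] = []
insertEach x (B ∷ π) = ((x ∷ B) ∷ π) ∷ map (B ∷_) (insertEach x π)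

insertElem : ℕ → List (List ℕ) → List (List (List ℕ))
insertElem x π = ([ x ] ∷ π) ∷ insertEach x π

partitions : ℕ → List (List (List ℕ))
partitions zero = [] ∷ []
partitions (suc n) = concatMap (insertElem (suc n)) (partitions n)

countLe : ℕ → List ℕ → ℕ
countLe s [] = 0
countLe s (m ∷ B) = if m ≤ᵇ s then suc (countLe s B) else countLe s B

allB : {A : Set} → (A → Bool) → List A → Bool
allB p [] = true
allB p (x ∷ xs) = p x ∧ allB p xs

filterB : {A : Set} → (A → Bool) → List A → List A
filterB p [] = []
filterB p (x ∷ xs) = if p x then x ∷ filterB p xs else filterB p xs

-- π has exactly K blocks and 1,…,s lie in pairwise distinct blocks
admissible : ℕ → ℕ → List (List ℕ) → Bool
admissible s K π = (length π ≡ᵇ K) ∧ allB (λ B → countLe s B ≤ᵇ 1) π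

module _ {c ℓ : Level} (R : CommutativeRing c ℓ) where
  open CommutativeRing R

  ringSum : List Carrier → Carrier
  ringSum = foldr _+_ 0#

  ringProd : List Carrier → Carrier
  ringProd = foldr _*_ 1#

  fromℕ : ℕ → Carrier
  fromℕ zero = 0#
  fromℕ (suc n) = 1# + fromℕ n

  pow : Carrier → ℕ → Carrier
  pow x zero = 1#
  pow x (suc n) = x * pow x n

  sumTo : ℕ → (ℕ → Carrier) → Carrier
  sumTo zero f = f 0
  sumTo (suc r) f = sumTo r f + f (suc r)

  -- weight of a block: b_{|B|} if B meets {1..s}, else a_{|B|}
  -- (sequences are functions ℕ → Carrier, indexed from 1; index 0 unused)
  blockWeight : ℕ → (ℕ → Carrier) → (ℕ → Carrier) → List ℕ → Carrier
  blockWeight s a b B = if countLe s B ≡ᵇ 0 then a (length B) else b (length B)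

  sBell : ℕ → ℕ → ℕ → (ℕ → Carrier) → (ℕ → Carrier) → Carrier
  sBell s N K a b =
    ringSum (map (λ π → ringProd (map (blockWeight s a b) π))
                 (filterB (admissible s K) (partitions N)))

  zeroFirst : (ℕ → Carrier) → ℕ → Carrier
  zeroFirst a (suc zero) = 0#
  zeroFirst a l = a l

-- A partition enters the s-Bell polynomial only through its shape, the list of
-- (size, number of special elements) of its blocks. Shapes are built by adding the
-- elements one at a time, and a block with two special elements gets weight 0,
-- which encodes the admissibility condition; so when the r special elements are
-- added first, only the shape of r singletons survives. Writing the weight of each
-- singleton block as a₁ (resp. b₁) plus 0 and expanding the product, the weight of
-- a shape becomes a sum over sets of deleted singleton blocks, each contributing
-- a₁ or b₁, of the zeroed weight of the rest. Recording which of the n ordinary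
-- elements end up as deleted singletons yields a sum over binary words, i.e. the
-- binomial expansion in a₁; the r special singletons yield the one in b₁. What
-- remains after deleting i special and j ordinary singletons is built from r - i
-- special singletons and n - j ordinary elements and must have k - j + r - i
-- blocks: it sums to the zeroed s-Bell polynomial.
module Submission where

open import Defs
open import Level using (Level)
open import Data.Nat using (ℕ; _+_; _∸_)
open import Data.Nat.Combinatorics using (_C_)
open import Algebra.Bundles using (CommutativeRing)

import Algebra.Properties.CommutativeSemigroup as CommutativeSemigroupProperties
open import Data.Bool.Base using (Bool; true; false; if_then_else_; _∧_)
open import Data.Bool.Properties using (∧-zeroʳ; ∧-identityʳ)
open import Data.List.Base using (List; []; _∷_; map; concatMap; length; replicate; _++_)
open import Data.List.Properties using (map-∘; ++-identityʳ; length-replicate)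
import Data.List.Relation.Unary.All as All
open All using (All; []; _∷_)
open import Data.List.Relation.Unary.All.Properties using (map⁺; ++⁺; replicate⁺)
open import Data.List.Relation.Unary.Any using (Any; here; there)
open import Data.Nat.Base using (zero; suc; _≤ᵇ_; _≡ᵇ_; _≤_; _<_; z≤n; s≤s)
open import Data.Nat.Combinatorics using (k>n⇒nCk≡0; nCk+nC[k+1]≡[n+1]C[k+1])
import Data.Nat.Properties as ℕ
open import Data.Product.Base using (_×_; _,_; proj₁; proj₂)
open import Function.Base using (_∘_)
open import Relation.Nullary.Decidable using (yes; no; dec-true; dec-false)
import Relation.Binary.PropositionalEquality as ≡
open ≡ using (_≡_)
import Relation.Binary.Reasoning.Setoid as SetoidReasoning

private
  variable
    A B : Set
  module ℕₚ = CommutativeSemigroupProperties ℕ.+-commutativeSemigroup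

≤ᵇ-true : ∀ {m n} → m ≤ n → (m ≤ᵇ n) ≡ true
≤ᵇ-true {m} {n} = dec-true (m ℕ.≤? n)

≤ᵇ-false : ∀ {m n} → n < m → (m ≤ᵇ n) ≡ false
≤ᵇ-false {m} {n} n<m = dec-false (m ℕ.≤? n) (ℕ.<⇒≱ n<m)

≡ᵇ-false : ∀ {m n} → n < m → (m ≡ᵇ n) ≡ false
≡ᵇ-false {m} {n} n<m = dec-false (m ℕ.≟ n) (ℕ.>⇒≢ n<m)

≡ᵇ-cancelˡ : ∀ e m n → (e + m ≡ᵇ e + n) ≡ (m ≡ᵇ n)
≡ᵇ-cancelˡ zero    m n = ≡.refl
≡ᵇ-cancelˡ (suc e) m n = ≡ᵇ-cancelˡ e m n

m+n≡i+j+[[m∸j]+[n∸i]] : ∀ {m n i j} → j ≤ m → i ≤ n → m + n ≡ (i + j) + ((m ∸ j) + (n ∸ i))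
m+n≡i+j+[[m∸j]+[n∸i]] {m} {n} {i} {j} j≤m i≤n = begin
  m + n                               ≡⟨ ≡.cong₂ _+_ (ℕ.m+[n∸m]≡n j≤m) (ℕ.m+[n∸m]≡n i≤n) ⟨
  (j + (m ∸ j)) + (i + (n ∸ i))       ≡⟨ ℕₚ.interchange j (m ∸ j) i (n ∸ i) ⟩
  (j + i) + ((m ∸ j) + (n ∸ i))       ≡⟨ ≡.cong (_+ ((m ∸ j) + (n ∸ i))) (ℕ.+-comm j i) ⟩
  (i + j) + ((m ∸ j) + (n ∸ i))       ∎
  where open ≡.≡-Reasoning

m<j⇒m+n<i+j+[n∸i] : ∀ {m n i j} → i ≤ n → m < j → m + n < (i + j) + (n ∸ i)
m<j⇒m+n<i+j+[n∸i] {m} {n} {i} {j} i≤n m<j = ≡.subst (m + n <_) eq (ℕ.+-monoˡ-< n m<j)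
  where
  eq : j + n ≡ (i + j) + (n ∸ i)
  eq = ≡.trans (≡.cong (j +_) (≡.sym (ℕ.m+[n∸m]≡n i≤n))) (≡.sym (ℕₚ.xy∙z≈y∙xz i j (n ∸ i)))

-- Shapes of partitions

-- (size of the block, number of special elements in it)
Block : Set
Block = ℕ × ℕ

Shape : Set
Shape = List Block

addIf : Bool → ℕ → ℕ
addIf special k = if special then suc k else k

n≤addIf : ∀ special n → n ≤ addIf special n
n≤addIf true  n = ℕ.n≤1+n n
n≤addIf false n = ℕ.≤-refl

enlargeOne : Bool → Shape → List Shape
enlargeOne special []             = []
enlargeOne special ((m , k) ∷ sh) =
  ((suc m , addIf special k) ∷ sh) ∷ map ((m , k) ∷_) (enlargeOne special sh)

extensions : Bool → Shape → List Shape
extensions special sh = ((1 , addIf special 0) ∷ sh) ∷ enlargeOne special sh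

blockShape : ℕ → List ℕ → Block
blockShape s B = length B , countLe s B

shape : ℕ → List (List ℕ) → Shape
shape s = map (blockShape s)

map-shape-insertEach : ∀ s x π →
  map (shape s) (insertEach x π) ≡ enlargeOne (x ≤ᵇ s) (shape s π)
map-shape-insertEach s x []      = ≡.refl
map-shape-insertEach s x (B ∷ π) = ≡.cong (shape s ((x ∷ B) ∷ π) ∷_) (begin
  map (shape s) (map (B ∷_) (insertEach x π))       ≡⟨ map-∘ (insertEach x π) ⟨
  map (λ π′ → blockShape s B ∷ shape s π′) (insertEach x π)
                                                    ≡⟨ map-∘ (insertEach x π) ⟩
  map (blockShape s B ∷_) (map (shape s) (insertEach x π))
                                                    ≡⟨ ≡.cong (map _) (map-shape-insertEach s x π) ⟩
  map (blockShape s B ∷_) (enlargeOne (x ≤ᵇ s) (shape s π)) ∎)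
  where open ≡.≡-Reasoning

map-shape-insertElem : ∀ s x π →
  map (shape s) (insertElem x π) ≡ extensions (x ≤ᵇ s) (shape s π)
map-shape-insertElem s x π = ≡.cong (shape s ((x ∷ []) ∷ π) ∷_) (map-shape-insertEach s x π)

specialSingletons : ℕ → Shape
specialSingletons r = replicate r (1 , 1)

Clash : Shape → Set
Clash = Any ((2 ≤_) ∘ proj₂)

NonemptyBlocks : Shape → Set
NonemptyBlocks = All ((1 ≤_) ∘ proj₁)

SpecialBlocks : Shape → Set
SpecialBlocks = All ((1 ≤_) ∘ proj₂)

enlargeOne-Clash : ∀ special sh → Clash sh → All Clash (enlargeOne special sh)
enlargeOne-Clash special ((m , k) ∷ sh) (here 2≤k) =
  here (ℕ.≤-trans 2≤k (n≤addIf special k))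
    ∷ map⁺ (All.universal (λ _ → here 2≤k) (enlargeOne special sh))
enlargeOne-Clash special ((m , k) ∷ sh) (there c) =
  there c ∷ map⁺ (All.map there (enlargeOne-Clash special sh c))

extensions-Clash : ∀ special {sh} → Clash sh → All Clash (extensions special sh)
extensions-Clash special {sh} c = there c ∷ enlargeOne-Clash special sh c

enlargeOne-SpecialBlocks : ∀ sh → SpecialBlocks sh → All Clash (enlargeOne true sh)
enlargeOne-SpecialBlocks []             []         = []
enlargeOne-SpecialBlocks ((m , k) ∷ sh) (1≤k ∷ ps) =
  here (s≤s 1≤k) ∷ map⁺ (All.map there (enlargeOne-SpecialBlocks sh ps))

enlargeOne-NonemptyBlocks : ∀ special sh → NonemptyBlocks sh →
  All NonemptyBlocks (enlargeOne special sh)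
enlargeOne-NonemptyBlocks special []             []       = []
enlargeOne-NonemptyBlocks special ((m , k) ∷ sh) (p ∷ ps) =
  (s≤s z≤n ∷ ps) ∷ map⁺ (All.map (p ∷_) (enlargeOne-NonemptyBlocks special sh ps))

enlargeOne-length : ∀ special sh → All (λ y → length y ≡ length sh) (enlargeOne special sh)
enlargeOne-length special []             = []
enlargeOne-length special ((m , k) ∷ sh) =
  ≡.refl ∷ map⁺ (All.map (≡.cong suc) (enlargeOne-length special sh))

extensions-length : ∀ special sh → All (λ y → length sh ≤ length y) (extensions special sh)
extensions-length special sh =
  ℕ.n≤1+n (length sh) ∷ All.map (ℕ.≤-reflexive ∘ ≡.sym) (enlargeOne-length special sh)

extensions-longer : ∀ special {K e sh} → K < e + length sh →
  All (λ y → K < e + length y) (extensions special sh)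
extensions-longer special {e = e} {sh} lt =
  All.map (λ le → ℕ.<-≤-trans lt (ℕ.+-monoʳ-≤ e le)) (extensions-length special sh)

module Sums {c ℓ : Level} (R : CommutativeRing c ℓ) where
  open CommutativeRing R hiding (zero) renaming (_+_ to _+R_)
  open SetoidReasoning setoid
  private
    module +ₚ = CommutativeSemigroupProperties +-commutativeSemigroup
    module *ₚ = CommutativeSemigroupProperties *-commutativeSemigroup

  sumOver : (A → Carrier) → List A → Carrier
  sumOver f xs = ringSum R (map f xs)

  sumOver-cong : ∀ {f g : A → Carrier} xs → (∀ x → f x ≈ g x) → sumOver f xs ≈ sumOver g xs
  sumOver-cong []       eq = refl
  sumOver-cong (x ∷ xs) eq = +-cong (eq x) (sumOver-cong xs eq)

  sumOver-congᴬ : ∀ {P : A → Set} {f g : A → Carrier} {xs} → All P xs →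
    (∀ x → P x → f x ≈ g x) → sumOver f xs ≈ sumOver g xs
  sumOver-congᴬ []       eq = refl
  sumOver-congᴬ (p ∷ ps) eq = +-cong (eq _ p) (sumOver-congᴬ ps eq)

  sumOver-zero : ∀ {P : A → Set} {f : A → Carrier} {xs} → All P xs →
    (∀ x → P x → f x ≈ 0#) → sumOver f xs ≈ 0#
  sumOver-zero []       eq = refl
  sumOver-zero (p ∷ ps) eq = trans (+-cong (eq _ p) (sumOver-zero ps eq)) (+-identityˡ 0#)

  sumOver-+ : ∀ (f g : A → Carrier) xs →
    sumOver (λ x → f x +R g x) xs ≈ sumOver f xs +R sumOver g xs
  sumOver-+ f g []       = sym (+-identityˡ 0#)
  sumOver-+ f g (x ∷ xs) = trans (+-congˡ (sumOver-+ f g xs)) (+ₚ.interchange _ _ _ _)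

  sumOver-* : ∀ y (f : A → Carrier) xs → sumOver (λ x → y * f x) xs ≈ y * sumOver f xs
  sumOver-* y f []       = sym (zeroʳ y)
  sumOver-* y f (x ∷ xs) = trans (+-congˡ (sumOver-* y f xs)) (sym (distribˡ y _ _))

  sumOver-++ : ∀ (f : A → Carrier) xs ys → sumOver f (xs ++ ys) ≈ sumOver f xs +R sumOver f ys
  sumOver-++ f []       ys = sym (+-identityˡ _)
  sumOver-++ f (x ∷ xs) ys = trans (+-congˡ (sumOver-++ f xs ys)) (sym (+-assoc _ _ _))

  sumOver-concatMap : ∀ (f : B → Carrier) (g : A → List B) xs →
    sumOver f (concatMap g xs) ≈ sumOver (λ x → sumOver f (g x)) xs
  sumOver-concatMap f g []       = refl
  sumOver-concatMap f g (x ∷ xs) =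
    trans (sumOver-++ f (g x) (concatMap g xs)) (+-congˡ (sumOver-concatMap f g xs))

  sumOver-map : ∀ (f : B → Carrier) (g : A → B) xs → sumOver (f ∘ g) xs ≡ sumOver f (map g xs)
  sumOver-map f g xs = ≡.cong (ringSum R) (map-∘ xs)

  ringSum-filterB : ∀ (f : A → Carrier) p xs →
    ringSum R (map f (filterB p xs)) ≈ sumOver (λ x → if p x then f x else 0#) xs
  ringSum-filterB f p []       = refl
  ringSum-filterB f p (x ∷ xs) with p x
  ... | true  = +-congˡ (ringSum-filterB f p xs)
  ... | false = trans (ringSum-filterB f p xs) (sym (+-identityˡ _))

  sumTo-cong : ∀ n {f g : ℕ → Carrier} → (∀ j → j ≤ n → f j ≈ g j) →
    sumTo R n f ≈ sumTo R n g
  sumTo-cong zero    eq = eq 0 z≤n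
  sumTo-cong (suc n) eq =
    +-cong (sumTo-cong n (λ j j≤n → eq j (ℕ.m≤n⇒m≤1+n j≤n))) (eq (suc n) ℕ.≤-refl)

  sumTo-zero : ∀ n {f : ℕ → Carrier} → (∀ j → j ≤ n → f j ≈ 0#) → sumTo R n f ≈ 0#
  sumTo-zero zero    eq = eq 0 z≤n
  sumTo-zero (suc n) eq =
    trans (+-cong (sumTo-zero n (λ j j≤n → eq j (ℕ.m≤n⇒m≤1+n j≤n))) (eq (suc n) ℕ.≤-refl))
          (+-identityˡ 0#)

  sumTo-+ : ∀ n (f g : ℕ → Carrier) → sumTo R n (λ j → f j +R g j) ≈ sumTo R n f +R sumTo R n g
  sumTo-+ zero    f g = refl
  sumTo-+ (suc n) f g = trans (+-congʳ (sumTo-+ n f g)) (+ₚ.interchange _ _ _ _)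

  sumTo-* : ∀ n y (f : ℕ → Carrier) → sumTo R n (λ j → y * f j) ≈ y * sumTo R n f
  sumTo-* zero    y f = refl
  sumTo-* (suc n) y f = trans (+-congʳ (sumTo-* n y f)) (sym (distribˡ y _ _))

  sumTo-unfoldˡ : ∀ n (f : ℕ → Carrier) → sumTo R (suc n) f ≈ f 0 +R sumTo R n (f ∘ suc)
  sumTo-unfoldˡ zero    f = refl
  sumTo-unfoldˡ (suc n) f = trans (+-congʳ (sumTo-unfoldˡ n f)) (+-assoc _ _ _)

  sumTo-comm : ∀ m n (f : ℕ → ℕ → Carrier) →
    sumTo R m (λ i → sumTo R n (f i)) ≈ sumTo R n (λ j → sumTo R m (λ i → f i j))
  sumTo-comm zero    n f = refl
  sumTo-comm (suc m) n f = trans (+-congʳ (sumTo-comm m n f)) (sym (sumTo-+ n _ _))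

  sumTo-+-vanishing : ∀ e n {f : ℕ → Carrier} → (∀ j → n < j → f j ≈ 0#) →
    sumTo R (e + n) f ≈ sumTo R n f
  sumTo-+-vanishing zero    n vanish = refl
  sumTo-+-vanishing (suc e) n vanish =
    trans (+-cong (sumTo-+-vanishing e n vanish) (vanish _ (s≤s (ℕ.m≤n+m n e))))
          (+-identityʳ _)

  sumTo-vanishing : ∀ m n {f : ℕ → Carrier} →
    (∀ j → m < j → f j ≈ 0#) → (∀ j → n < j → f j ≈ 0#) → sumTo R m f ≈ sumTo R n f
  sumTo-vanishing m n {f} vanish-m vanish-n = begin
    sumTo R m f       ≈⟨ sumTo-+-vanishing n m vanish-m ⟨
    sumTo R (n + m) f ≡⟨ ≡.cong (λ t → sumTo R t f) (ℕ.+-comm n m) ⟩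
    sumTo R (m + n) f ≈⟨ sumTo-+-vanishing m n vanish-n ⟩
    sumTo R n f       ∎

  fromℕ-+ : ∀ m n → fromℕ R (m + n) ≈ fromℕ R m +R fromℕ R n
  fromℕ-+ zero    n = sym (+-identityˡ _)
  fromℕ-+ (suc m) n = trans (+-congˡ (fromℕ-+ m n)) (sym (+-assoc _ _ _))

  *-rearrange : ∀ p q u v z → p * q * (u * v * z) ≈ u * p * v * q * z
  *-rearrange p q u v z = begin
    p * q * (u * v * z)     ≈⟨ *-assoc (p * q) (u * v) z ⟨
    p * q * (u * v) * z     ≈⟨ *-congʳ (*ₚ.interchange p q u v) ⟩
    p * u * (q * v) * z     ≈⟨ *-congʳ (*-cong (*-comm p u) (*-comm q v)) ⟩
    u * p * (v * q) * z     ≈⟨ *-congʳ (*-assoc (u * p) v q) ⟨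
    u * p * v * q * z       ∎

  -- Binary choices and the binomial theorem

  -- Sum over the words in {x, ·}ⁿ of x^(number of x) · f (number of x) (number of ·).
  choices : Carrier → ℕ → (ℕ → ℕ → Carrier) → Carrier
  choices x zero    f = f 0 0
  choices x (suc n) f =
    x * choices x n (λ j m → f (suc j) m) +R choices x n (λ j m → f j (suc m))

  choices-cong : ∀ x n {f g : ℕ → ℕ → Carrier} → (∀ j m → f j m ≈ g j m) →
    choices x n f ≈ choices x n g
  choices-cong x zero    eq = eq 0 0
  choices-cong x (suc n) eq =
    +-cong (*-congˡ (choices-cong x n (λ j → eq (suc j)))) (choices-cong x n (λ j m → eq j (suc m)))

  choices-+ : ∀ x n (f g : ℕ → ℕ → Carrier) →
    choices x n (λ j m → f j m +R g j m) ≈ choices x n f +R choices x n g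
  choices-+ x zero    f g = refl
  choices-+ x (suc n) f g =
    trans (+-cong (trans (*-congˡ (choices-+ x n _ _)) (distribˡ x _ _)) (choices-+ x n _ _))
          (+ₚ.interchange _ _ _ _)

  choices-* : ∀ x n y (f : ℕ → ℕ → Carrier) →
    choices x n (λ j m → y * f j m) ≈ y * choices x n f
  choices-* x zero    y f = refl
  choices-* x (suc n) y f =
    trans (+-cong (trans (*-congˡ (choices-* x n y _)) (*ₚ.x∙yz≈y∙xz x y _)) (choices-* x n y _))
          (sym (distribˡ y _ _))

  choices-zero : ∀ x n → choices x n (λ _ _ → 0#) ≈ 0#
  choices-zero x zero    = refl
  choices-zero x (suc n) =
    trans (+-cong (trans (*-congˡ (choices-zero x n)) (zeroʳ x)) (choices-zero x n)) (+-identityˡ 0#)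

  sumOver-choices : ∀ x n (f : A → ℕ → ℕ → Carrier) xs →
    sumOver (λ y → choices x n (f y)) xs ≈ choices x n (λ j m → sumOver (λ y → f y j m) xs)
  sumOver-choices x n f []       = sym (choices-zero x n)
  sumOver-choices x n f (y ∷ ys) = trans (+-congˡ (sumOver-choices x n f ys)) (sym (choices-+ x n _ _))

  binomialTerm : Carrier → ℕ → (ℕ → ℕ → Carrier) → ℕ → Carrier
  binomialTerm x n f j = fromℕ R (n C j) * pow R x j * f j (n ∸ j)

  nCk-vanishing : ∀ {n j} → n < j → ∀ y z → fromℕ R (n C j) * y * z ≈ 0#
  nCk-vanishing n<j y z rewrite k>n⇒nCk≡0 n<j = trans (*-congʳ (zeroˡ y)) (zeroˡ z)

  choices≈binomialSum : ∀ x n f → choices x n f ≈ sumTo R n (binomialTerm x n f)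
  choices≈binomialSum x zero    f =
    sym (trans (*-congʳ (trans (*-congʳ (+-identityʳ 1#)) (*-identityˡ 1#))) (*-identityˡ _))
  choices≈binomialSum x (suc n) f = begin
    x * choices x n f↑ +R choices x n f→
      ≈⟨ +-cong (*-congˡ (choices≈binomialSum x n f↑)) (choices≈binomialSum x n f→) ⟩
    x * sumTo R n (binomialTerm x n f↑) +R sumTo R n (binomialTerm x n f→)
      ≈⟨ +-congˡ (sumTo-+-vanishing 1 n (λ j n<j → nCk-vanishing n<j _ _)) ⟨
    x * sumTo R n (binomialTerm x n f↑) +R sumTo R (suc n) (binomialTerm x n f→)
      ≈⟨ +-congˡ (trans (sumTo-unfoldˡ n (binomialTerm x n f→))
                        (+-congˡ (sumTo-cong n (λ j _ → binomialTerm-new j)))) ⟩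
    x * sumTo R n (binomialTerm x n f↑) +R (binomialTerm x (suc n) f 0 +R sumTo R n new)
      ≈⟨ +ₚ.x∙yz≈y∙xz _ _ _ ⟩
    binomialTerm x (suc n) f 0 +R (x * sumTo R n (binomialTerm x n f↑) +R sumTo R n new)
      ≈⟨ +-congˡ (+-congʳ (sumTo-* n x _)) ⟨
    binomialTerm x (suc n) f 0 +R (sumTo R n (λ j → x * binomialTerm x n f↑ j) +R sumTo R n new)
      ≈⟨ +-congˡ (sumTo-+ n _ _) ⟨
    binomialTerm x (suc n) f 0 +R sumTo R n (λ j → x * binomialTerm x n f↑ j +R new j)
      ≈⟨ +-congˡ (sumTo-cong n (λ j _ → pascal j)) ⟨
    binomialTerm x (suc n) f 0 +R sumTo R n (binomialTerm x (suc n) f ∘ suc)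
      ≈⟨ sumTo-unfoldˡ n (binomialTerm x (suc n) f) ⟨
    sumTo R (suc n) (binomialTerm x (suc n) f) ∎
    where
    f↑ f→ : ℕ → ℕ → Carrier
    f↑ j m = f (suc j) m
    f→ j m = f j (suc m)
    new : ℕ → Carrier
    new j = fromℕ R (n C suc j) * pow R x (suc j) * f (suc j) (n ∸ j)
    -- suc (n ∸ suc j) ≡ n ∸ j only for suc j ≤ n; otherwise n C suc j = 0
    binomialTerm-new : ∀ j → binomialTerm x n f→ (suc j) ≈ new j
    binomialTerm-new j with suc j ℕ.≤? n
    ... | yes j<n = reflexive (≡.cong (λ t → fromℕ R (n C suc j) * pow R x (suc j) * f (suc j) t)
                                      (≡.sym (ℕ.+-∸-assoc 1 j<n)))
    ... | no  j≮n = trans (nCk-vanishing (ℕ.≰⇒> j≮n) _ _) (sym (nCk-vanishing (ℕ.≰⇒> j≮n) _ _))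
    pascal : ∀ j → binomialTerm x (suc n) f (suc j) ≈ x * binomialTerm x n f↑ j +R new j
    pascal j = begin
      fromℕ R (suc n C suc j) * (x * pow R x j) * f (suc j) (n ∸ j)
        ≡⟨ ≡.cong (λ t → fromℕ R t * (x * pow R x j) * f (suc j) (n ∸ j))
                  (nCk+nC[k+1]≡[n+1]C[k+1] n j) ⟨
      fromℕ R (n C j + n C suc j) * (x * pow R x j) * f (suc j) (n ∸ j)
        ≈⟨ *-congʳ (*-congʳ (fromℕ-+ (n C j) (n C suc j))) ⟩
      (fromℕ R (n C j) +R fromℕ R (n C suc j)) * (x * pow R x j) * f (suc j) (n ∸ j)
        ≈⟨ trans (*-congʳ (distribʳ _ _ _)) (distribʳ _ _ _) ⟩
      fromℕ R (n C j) * (x * pow R x j) * f (suc j) (n ∸ j) +R new j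
        ≈⟨ +-congʳ (trans (*-congʳ (*ₚ.x∙yz≈y∙xz _ _ _)) (*-assoc _ _ _)) ⟩
      x * binomialTerm x n f↑ j +R new j ∎

module ShapeSums {c ℓ : Level} (R : CommutativeRing c ℓ) where
  open CommutativeRing R hiding (zero) renaming (_+_ to _+R_)
  open SetoidReasoning setoid
  open Sums R
  private
    module +ₚ = CommutativeSemigroupProperties +-commutativeSemigroup
    module *ₚ = CommutativeSemigroupProperties *-commutativeSemigroup

  bySpecials : ℕ → Carrier → Carrier → Carrier
  bySpecials zero          x y = x
  bySpecials (suc zero)    x y = y
  bySpecials (suc (suc _)) x y = 0#

  weight : (ℕ → Carrier) → (ℕ → Carrier) → Block → Carrier
  weight a b (m , k) = bySpecials k (a m) (b m)

  singletonWeight : (ℕ → Carrier) → (ℕ → Carrier) → Block → Carrier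
  singletonWeight a b (zero , k)        = 0#
  singletonWeight a b (suc zero , k)    = weight a b (1 , k)
  singletonWeight a b (suc (suc m) , k) = 0#

  bySpecials-zero : ∀ k → bySpecials k 0# 0# ≈ 0#
  bySpecials-zero zero          = refl
  bySpecials-zero (suc zero)    = refl
  bySpecials-zero (suc (suc _)) = refl

  weight-split : ∀ a b B →
    singletonWeight a b B +R weight (zeroFirst R a) (zeroFirst R b) B ≈ weight a b B
  weight-split a b (zero , k)        = +-identityˡ _
  weight-split a b (suc zero , k)    = trans (+-congˡ (bySpecials-zero k)) (+-identityʳ _)
  weight-split a b (suc (suc m) , k) = +-identityˡ _

  -- ∏ w B over the blocks B of sh if d + length sh = K, and 0 otherwise
  shapeWeight : (Block → Carrier) → ℕ → ℕ → Shape → Carrier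
  shapeWeight w K d []       = if d ≡ᵇ K then 1# else 0#
  shapeWeight w K d (B ∷ sh) = w B * shapeWeight w K (suc d) sh

  shapeWeight-shift : ∀ w e K d sh → shapeWeight w (e + K) (e + d) sh ≡ shapeWeight w K d sh
  shapeWeight-shift w e K d []       = ≡.cong (λ q → if q then 1# else 0#) (≡ᵇ-cancelˡ e d K)
  shapeWeight-shift w e K d (B ∷ sh) = ≡.cong (w B *_)
    (≡.trans (≡.cong (λ t → shapeWeight w (e + K) t sh) (≡.sym (ℕ.+-suc e d)))
             (shapeWeight-shift w e K (suc d) sh))

  Vanishes : (Shape → Set) → (Shape → Carrier) → Set ℓ
  Vanishes P h = ∀ sh → P sh → h sh ≈ 0#

  shapeWeight-Clash : ∀ a b K d → Vanishes Clash (shapeWeight (weight a b) K d)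
  shapeWeight-Clash a b K d (_ ∷ sh) (here (s≤s (s≤s _))) = zeroˡ _
  shapeWeight-Clash a b K d (_ ∷ sh) (there c) =
    trans (*-congˡ (shapeWeight-Clash a b K (suc d) sh c)) (zeroʳ _)

  shapeWeight-long : ∀ w K d → Vanishes (λ sh → K < d + length sh) (shapeWeight w K d)
  shapeWeight-long w K d [] lt
    rewrite ≡ᵇ-false (≡.subst (K <_) (ℕ.+-identityʳ d) lt) = refl
  shapeWeight-long w K d (B ∷ sh) lt =
    trans (*-congˡ (shapeWeight-long w K (suc d) sh (≡.subst (K <_) (ℕ.+-suc d _) lt))) (zeroʳ _)

  extend : Bool → (Shape → Carrier) → Shape → Carrier
  extend special g sh = sumOver g (extensions special sh)

  extendⁿ : Bool → ℕ → (Shape → Carrier) → Shape → Carrier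
  extendⁿ special zero    g = g
  extendⁿ special (suc n) g = extendⁿ special n (extend special g)

  -- Sums g over all shapes reached from the argument by adding the elements
  -- 1, …, N in this order, element l being special iff l ≤ s.
  extendLabels : ℕ → ℕ → (Shape → Carrier) → Shape → Carrier
  extendLabels s zero    g = g
  extendLabels s (suc N) g = extendLabels s N (extend (suc N ≤ᵇ s) g)

  extendⁿ-suc : ∀ special n g sh →
    extendⁿ special (suc n) g sh ≡ extend special (extendⁿ special n g) sh
  extendⁿ-suc special zero    g sh = ≡.refl
  extendⁿ-suc special (suc n) g sh = extendⁿ-suc special n (extend special g) sh

  extendⁿ-cong : ∀ special n {g h : Shape → Carrier} → (∀ sh → g sh ≈ h sh) →
    ∀ sh → extendⁿ special n g sh ≈ extendⁿ special n h sh
  extendⁿ-cong special zero    eq = eq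
  extendⁿ-cong special (suc n) eq =
    extendⁿ-cong special n (λ sh → sumOver-cong (extensions special sh) eq)

  extendⁿ-vanishes : ∀ {P} special → (∀ {sh} → P sh → All P (extensions special sh)) →
    ∀ n {h} → Vanishes P h → Vanishes P (extendⁿ special n h)
  extendⁿ-vanishes special closed zero    vanish = vanish
  extendⁿ-vanishes special closed (suc n) vanish =
    extendⁿ-vanishes special closed n (λ sh p → sumOver-zero (closed p) vanish)

  extendLabels-ordinary : ∀ s n g → extendLabels s (n + s) g ≡ extendLabels s s (extendⁿ false n g)
  extendLabels-ordinary s zero    g = ≡.refl
  extendLabels-ordinary s (suc n) g
    rewrite ≤ᵇ-false (s≤s (ℕ.m≤n+m s n)) = extendLabels-ordinary s n (extend false g)

  extendLabels-special : ∀ s m g → m ≤ s → extendLabels s m g ≡ extendⁿ true m g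
  extendLabels-special s zero    g _ = ≡.refl
  extendLabels-special s (suc m) g m<s
    rewrite ≤ᵇ-true m<s = extendLabels-special s m (extend true g) (ℕ.<⇒≤ m<s)

  extendⁿ-specials : ∀ r {h} t → Vanishes Clash h → SpecialBlocks t →
    extendⁿ true r h t ≈ h (specialSingletons r ++ t)
  extendⁿ-specials zero    t vanish ts = refl
  extendⁿ-specials (suc r) {h} t vanish ts = begin
    extendⁿ true r (extend true h) t
      ≈⟨ extendⁿ-specials r t (λ sh c → sumOver-zero (extensions-Clash true c) vanish) ts ⟩
    h (specialSingletons (suc r) ++ t) +R sumOver h (enlargeOne true (specialSingletons r ++ t))
      ≈⟨ +-congˡ (sumOver-zero clashes vanish) ⟩
    h (specialSingletons (suc r) ++ t) +R 0#
      ≈⟨ +-identityʳ _ ⟩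
    h (specialSingletons (suc r) ++ t) ∎
    where
    clashes : All Clash (enlargeOne true (specialSingletons r ++ t))
    clashes = enlargeOne-SpecialBlocks _ (++⁺ (replicate⁺ r (s≤s z≤n)) ts)

  -- From partitions to shapes

  sumOver-partitions : ∀ s N (g : Shape → Carrier) →
    sumOver (g ∘ shape s) (partitions N) ≈ extendLabels s N g []
  sumOver-partitions s zero    g = +-identityʳ _
  sumOver-partitions s (suc N) g = begin
    sumOver (g ∘ shape s) (concatMap (insertElem (suc N)) (partitions N))
      ≈⟨ sumOver-concatMap _ (insertElem (suc N)) (partitions N) ⟩
    sumOver (λ π → sumOver (g ∘ shape s) (insertElem (suc N) π)) (partitions N)
      ≈⟨ sumOver-cong (partitions N) (λ π → reflexive (≡.trans
           (sumOver-map g (shape s) (insertElem (suc N) π))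
           (≡.cong (sumOver g) (map-shape-insertElem s (suc N) π)))) ⟩
    sumOver (extend (suc N ≤ᵇ s) g ∘ shape s) (partitions N)
      ≈⟨ sumOver-partitions s N (extend (suc N ≤ᵇ s) g) ⟩
    extendLabels s (suc N) g [] ∎

  if-* : ∀ q x y → (if q then x * y else 0#) ≈ x * (if q then y else 0#)
  if-* true  x y = refl
  if-* false x y = sym (zeroʳ x)

  admissible-weight : ∀ s K a b d π →
    (if (d + length π ≡ᵇ K) ∧ allB (λ B → countLe s B ≤ᵇ 1) π
       then ringProd R (map (blockWeight R s a b) π) else 0#)
      ≈ shapeWeight (weight a b) K d (shape s π)
  admissible-weight s K a b d []
    rewrite ℕ.+-identityʳ d | ∧-identityʳ (d ≡ᵇ K) = refl
  admissible-weight s K a b d (B ∷ π)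
    rewrite ℕ.+-suc d (length π) =
      guarded (countLe s B) (suc (d + length π) ≡ᵇ K) (allB (λ B → countLe s B ≤ᵇ 1) π)
              (admissible-weight s K a b (suc d) π)
    where
    guarded : ∀ k e r {P Q} → (if e ∧ r then P else 0#) ≈ Q →
      (if e ∧ ((k ≤ᵇ 1) ∧ r) then (if k ≡ᵇ 0 then a (length B) else b (length B)) * P else 0#)
        ≈ weight a b (length B , k) * Q
    guarded zero          e r eq = trans (if-* (e ∧ r) _ _) (*-congˡ eq)
    guarded (suc zero)    e r eq = trans (if-* (e ∧ r) _ _) (*-congˡ eq)
    guarded (suc (suc k)) e r eq rewrite ∧-zeroʳ e = sym (zeroˡ _)

  sBell≈extendLabels : ∀ s N K a b →
    sBell R s N K a b ≈ extendLabels s N (shapeWeight (weight a b) K 0) []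
  sBell≈extendLabels s N K a b =
    trans (ringSum-filterB _ (admissible s K) (partitions N))
          (trans (sumOver-cong (partitions N) (admissible-weight s K a b 0))
                 (sumOver-partitions s N _))

  sBell≈extendⁿ : ∀ s n K a b →
    sBell R s (n + s) K a b ≈ extendⁿ false n (shapeWeight (weight a b) K 0) (specialSingletons s)
  sBell≈extendⁿ s n K a b = begin
    sBell R s (n + s) K a b
      ≈⟨ sBell≈extendLabels s (n + s) K a b ⟩
    extendLabels s (n + s) g []
      ≡⟨ ≡.cong (λ f → f []) (extendLabels-ordinary s n g) ⟩
    extendLabels s s (extendⁿ false n g) []
      ≡⟨ ≡.cong (λ f → f []) (extendLabels-special s s _ ℕ.≤-refl) ⟩
    extendⁿ true s (extendⁿ false n g) []
      ≈⟨ extendⁿ-specials s [] (extendⁿ-vanishes false (extensions-Clash false) n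
                                  (shapeWeight-Clash a b K 0)) [] ⟩
    extendⁿ false n g (specialSingletons s ++ [])
      ≡⟨ ≡.cong (extendⁿ false n g) (++-identityʳ _) ⟩
    extendⁿ false n g (specialSingletons s) ∎
    where
    g : Shape → Carrier
    g = shapeWeight (weight a b) K 0

  sBell≈extendⁿ-shifted : ∀ s n e K a b →
    extendⁿ false n (shapeWeight (weight a b) (e + K) e) (specialSingletons s) ≈ sBell R s (n + s) K a b
  sBell≈extendⁿ-shifted s n e K a b =
    trans (extendⁿ-cong false n (λ sh → reflexive (≡.trans
             (≡.cong (λ d → shapeWeight (weight a b) (e + K) d sh) (≡.sym (ℕ.+-identityʳ e)))
             (shapeWeight-shift (weight a b) e K 0 sh))) (specialSingletons s))
          (sym (sBell≈extendⁿ s n K a b))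

  -- Deleting blocks

  -- Σ over the sets D of blocks of sh of (∏_{B ∈ D} δ B) · F (sh without D) |D|
  sumSubshapes : (Block → Carrier) → Shape → (Shape → ℕ → Carrier) → Carrier
  sumSubshapes δ []       F = F [] 0
  sumSubshapes δ (B ∷ sh) F =
    δ B * sumSubshapes δ sh (λ s i → F s (suc i)) +R sumSubshapes δ sh (λ s i → F (B ∷ s) i)

  sumSubshapes-cong : ∀ δ sh {F G : Shape → ℕ → Carrier} → (∀ s i → F s i ≈ G s i) →
    sumSubshapes δ sh F ≈ sumSubshapes δ sh G
  sumSubshapes-cong δ []       eq = eq [] 0
  sumSubshapes-cong δ (B ∷ sh) eq =
    +-cong (*-congˡ (sumSubshapes-cong δ sh (λ s i → eq s (suc i))))
           (sumSubshapes-cong δ sh (λ s → eq (B ∷ s)))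

  sumSubshapes-+ : ∀ δ sh (F G : Shape → ℕ → Carrier) →
    sumSubshapes δ sh (λ s i → F s i +R G s i) ≈ sumSubshapes δ sh F +R sumSubshapes δ sh G
  sumSubshapes-+ δ []       F G = refl
  sumSubshapes-+ δ (B ∷ sh) F G =
    trans (+-cong (trans (*-congˡ (sumSubshapes-+ δ sh _ _)) (distribˡ _ _ _))
                  (sumSubshapes-+ δ sh _ _))
          (+ₚ.interchange _ _ _ _)

  sumSubshapes-* : ∀ δ sh x (F : Shape → ℕ → Carrier) →
    sumSubshapes δ sh (λ s i → x * F s i) ≈ x * sumSubshapes δ sh F
  sumSubshapes-* δ []       x F = refl
  sumSubshapes-* δ (B ∷ sh) x F =
    trans (+-cong (trans (*-congˡ (sumSubshapes-* δ sh x _)) (*ₚ.x∙yz≈y∙xz _ x _))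
                  (sumSubshapes-* δ sh x _))
          (sym (distribˡ x _ _))

  sumSubshapes-replicate : ∀ δ B r F →
    sumSubshapes δ (replicate r B) F ≈ choices (δ B) r (λ i m → F (replicate m B) i)
  sumSubshapes-replicate δ B zero    F = refl
  sumSubshapes-replicate δ B (suc r) F =
    +-cong (*-congˡ (sumSubshapes-replicate δ B r _)) (sumSubshapes-replicate δ B r _)

  shapeWeight-expand : ∀ {δ w w₀} → (∀ B → δ B +R w₀ B ≈ w B) → ∀ K d sh →
    shapeWeight w K d sh ≈ sumSubshapes δ sh (λ s i → shapeWeight w₀ K (i + d) s)
  shapeWeight-expand split K d []                     = refl
  shapeWeight-expand {δ} {w} {w₀} split K d (B ∷ sh) = begin
    w B * shapeWeight w K (suc d) sh
      ≈⟨ *-cong (sym (split B)) (trans (shapeWeight-expand split K (suc d) sh)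
                 (sumSubshapes-cong δ sh (λ s i → reflexive
                   (≡.cong (λ t → shapeWeight w₀ K t s) (ℕ.+-suc i d))))) ⟩
    (δ B +R w₀ B) * rest
      ≈⟨ distribʳ rest (δ B) (w₀ B) ⟩
    δ B * rest +R w₀ B * rest
      ≈⟨ +-congˡ (sumSubshapes-* δ sh (w₀ B) _) ⟨
    sumSubshapes δ (B ∷ sh) (λ s i → shapeWeight w₀ K (i + d) s) ∎
    where
    rest : Carrier
    rest = sumSubshapes δ sh (λ s i → shapeWeight w₀ K (suc i + d) s)

  -- Enlarging a block of size at least 1 makes it undeletable, so enlarging
  -- commutes with deleting blocks.
  sumOver-enlargeOne : ∀ {δ} → (∀ m k → δ (suc (suc m) , k) ≈ 0#) →
    ∀ special sh → NonemptyBlocks sh → ∀ F →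
    sumOver (λ y → sumSubshapes δ y F) (enlargeOne special sh)
      ≈ sumSubshapes δ sh (λ s i → sumOver (λ y → F y i) (enlargeOne special s))
  sumOver-enlargeOne δ-big special []                     []       F = refl
  sumOver-enlargeOne {δ} δ-big special ((suc m , k) ∷ sh) (_ ∷ ps) F = begin
    (δ blk′ * sumSubshapes δ sh F↑ +R sumSubshapes δ sh (F ∘ (blk′ ∷_)))
      +R sumOver (λ y → sumSubshapes δ y F) (map (blk ∷_) E)
      ≈⟨ +-cong (trans (+-congʳ (trans (*-congʳ (δ-big m _)) (zeroˡ _))) (+-identityˡ _))
                (reflexive (≡.sym (sumOver-map (λ y → sumSubshapes δ y F) (blk ∷_) E))) ⟩
    sumSubshapes δ sh (F ∘ (blk′ ∷_))
      +R sumOver (λ y → δ blk * sumSubshapes δ y F↑ +R sumSubshapes δ y (F ∘ (blk ∷_))) E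
      ≈⟨ +-congˡ (trans (sumOver-+ (λ y → δ blk * sumSubshapes δ y F↑) _ E)
                        (+-congʳ (sumOver-* (δ blk) (λ y → sumSubshapes δ y F↑) E))) ⟩
    sumSubshapes δ sh (F ∘ (blk′ ∷_))
      +R (δ blk * sumOver (λ y → sumSubshapes δ y F↑) E
          +R sumOver (λ y → sumSubshapes δ y (F ∘ (blk ∷_))) E)
      ≈⟨ +-congˡ (+-cong (*-congˡ (sumOver-enlargeOne δ-big special sh ps F↑))
                         (sumOver-enlargeOne δ-big special sh ps (F ∘ (blk ∷_)))) ⟩
    sumSubshapes δ sh (F ∘ (blk′ ∷_)) +R (δ blk * after↑ +R afterB)
      ≈⟨ +ₚ.x∙yz≈y∙xz _ _ _ ⟩
    δ blk * after↑ +R (sumSubshapes δ sh (F ∘ (blk′ ∷_)) +R afterB)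
      ≈⟨ +-congˡ (trans (sym (sumSubshapes-+ δ sh _ _))
                        (sumSubshapes-cong δ sh (λ s i → reflexive
                          (≡.cong (F (blk′ ∷ s) i +R_)
                                  (sumOver-map (λ y → F y i) (blk ∷_) (enlargeOne special s)))))) ⟩
    sumSubshapes δ (blk ∷ sh) (λ s i → sumOver (λ y → F y i) (enlargeOne special s)) ∎
    where
    E : List Shape
    E = enlargeOne special sh
    blk blk′ : Block
    blk  = suc m , k
    blk′ = suc (suc m) , addIf special k
    F↑ : Shape → ℕ → Carrier
    F↑ s i = F s (suc i)
    after↑ afterB : Carrier
    after↑ = sumSubshapes δ sh (λ s i → sumOver (λ y → F↑ y i) (enlargeOne special s))
    afterB = sumSubshapes δ sh (λ s i → sumOver (λ y → F (blk ∷ y) i) (enlargeOne special s))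

  -- j counts the ordinary elements that become deleted singletons, m those that
  -- are still to be added to the remaining shape.
  extendⁿ-expand : ∀ a b K n sh → NonemptyBlocks sh →
    extendⁿ false n (shapeWeight (weight a b) K 0) sh
      ≈ choices (a 1) n (λ j m → sumSubshapes (singletonWeight a b) sh (λ s i →
          extendⁿ false m (shapeWeight (weight (zeroFirst R a) (zeroFirst R b)) K (i + j)) s))
  extendⁿ-expand a b K zero    sh _  = shapeWeight-expand (weight-split a b) K 0 sh
  extendⁿ-expand a b K (suc n) sh ne = begin
    extendⁿ false (suc n) g sh
      ≡⟨ extendⁿ-suc false n g sh ⟩
    extendⁿ false n g ((1 , 0) ∷ sh) +R sumOver (extendⁿ false n g) (enlargeOne false sh)
      ≈⟨ +-cong (extendⁿ-expand a b K n ((1 , 0) ∷ sh) (s≤s z≤n ∷ ne))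
                (sumOver-congᴬ (enlargeOne-NonemptyBlocks false sh ne) (extendⁿ-expand a b K n)) ⟩
    choices x n (λ j m → S ((1 , 0) ∷ sh) (G j m))
      +R sumOver (λ y → choices x n (λ j m → S y (G j m))) (enlargeOne false sh)
      ≈⟨ +-congˡ (sumOver-choices x n (λ y j m → S y (G j m)) (enlargeOne false sh)) ⟩
    choices x n (λ j m → S ((1 , 0) ∷ sh) (G j m))
      +R choices x n (λ j m → sumOver (λ y → S y (G j m)) (enlargeOne false sh))
      ≈⟨ choices-+ x n _ _ ⟨
    choices x n (λ j m → S ((1 , 0) ∷ sh) (G j m) +R sumOver (λ y → S y (G j m)) (enlargeOne false sh))
      ≈⟨ choices-cong x n step ⟩
    choices x n (λ j m → x * S sh (G (suc j) m) +R S sh (G j (suc m)))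
      ≈⟨ trans (choices-+ x n _ _) (+-congʳ (choices-* x n x _)) ⟩
    choices x (suc n) (λ j m → S sh (G j m)) ∎
    where
    x : Carrier
    x = a 1
    S : Shape → (Shape → ℕ → Carrier) → Carrier
    S = sumSubshapes (singletonWeight a b)
    g : Shape → Carrier
    g = shapeWeight (weight a b) K 0
    w₀ : Block → Carrier
    w₀ = weight (zeroFirst R a) (zeroFirst R b)
    G : ℕ → ℕ → Shape → ℕ → Carrier
    G j m s i = extendⁿ false m (shapeWeight w₀ K (i + j)) s
    step : ∀ j m → S ((1 , 0) ∷ sh) (G j m) +R sumOver (λ y → S y (G j m)) (enlargeOne false sh)
                     ≈ x * S sh (G (suc j) m) +R S sh (G j (suc m))
    step j m = begin
      (x * S sh (λ s i → G j m s (suc i)) +R S sh (λ s i → G j m ((1 , 0) ∷ s) i))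
        +R sumOver (λ y → S y (G j m)) (enlargeOne false sh)
        ≈⟨ +-assoc _ _ _ ⟩
      x * S sh (λ s i → G j m s (suc i))
        +R (S sh (λ s i → G j m ((1 , 0) ∷ s) i) +R sumOver (λ y → S y (G j m)) (enlargeOne false sh))
        ≈⟨ +-cong (*-congˡ (sumSubshapes-cong _ sh (λ s i → reflexive
                     (≡.cong (λ d → extendⁿ false m (shapeWeight w₀ K d) s) (≡.sym (ℕ.+-suc i j))))))
                  (+-congˡ (sumOver-enlargeOne (λ _ _ → refl) false sh ne (G j m))) ⟩
      x * S sh (G (suc j) m)
        +R (S sh (λ s i → G j m ((1 , 0) ∷ s) i)
            +R S sh (λ s i → sumOver (λ y → G j m y i) (enlargeOne false s)))
        ≈⟨ +-congˡ (sumSubshapes-+ _ sh _ _) ⟨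
      x * S sh (G (suc j) m) +R S sh (λ s i → extend false (λ y → G j m y i) s)
        ≈⟨ +-congˡ (sumSubshapes-cong _ sh (λ s i → reflexive (≡.sym (extendⁿ-suc false m _ s)))) ⟩
      x * S sh (G (suc j) m) +R S sh (G j (suc m)) ∎

  sBell≈binomialSum : ∀ a b n K r →
    sBell R r (n + r) K a b
      ≈ sumTo R n (λ j → fromℕ R (n C j) * pow R (a 1) j * sumTo R r (λ i →
          fromℕ R (r C i) * pow R (b 1) i
            * extendⁿ false (n ∸ j) (shapeWeight (weight (zeroFirst R a) (zeroFirst R b)) K (i + j))
                (specialSingletons (r ∸ i))))
  sBell≈binomialSum a b n K r = begin
    sBell R r (n + r) K a b
      ≈⟨ sBell≈extendⁿ r n K a b ⟩
    extendⁿ false n (shapeWeight (weight a b) K 0) (specialSingletons r)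
      ≈⟨ extendⁿ-expand a b K n _ (replicate⁺ r (s≤s z≤n)) ⟩
    choices (a 1) n (λ j m → sumSubshapes (singletonWeight a b) (specialSingletons r) (G j m))
      ≈⟨ choices-cong (a 1) n (λ j m → sumSubshapes-replicate _ (1 , 1) r (G j m)) ⟩
    choices (a 1) n (λ j m → choices (b 1) r (λ i m′ → G j m (specialSingletons m′) i))
      ≈⟨ choices≈binomialSum (a 1) n _ ⟩
    sumTo R n (binomialTerm (a 1) n (λ j m → choices (b 1) r (λ i m′ → G j m (specialSingletons m′) i)))
      ≈⟨ sumTo-cong n (λ j _ → *-congˡ (choices≈binomialSum (b 1) r _)) ⟩
    sumTo R n (λ j → fromℕ R (n C j) * pow R (a 1) j * sumTo R r (λ i →
      fromℕ R (r C i) * pow R (b 1) i * G j (n ∸ j) (specialSingletons (r ∸ i)) i)) ∎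
    where
    G : ℕ → ℕ → Shape → ℕ → Carrier
    G j m s i = extendⁿ false m (shapeWeight (weight (zeroFirst R a) (zeroFirst R b)) K (i + j)) s

  extendⁿ-tooManyBlocks : ∀ w n k r i j → i ≤ r → k < j →
    extendⁿ false n (shapeWeight w (k + r) (i + j)) (specialSingletons (r ∸ i)) ≈ 0#
  extendⁿ-tooManyBlocks w n k r i j i≤r k<j =
    extendⁿ-vanishes false (extensions-longer false) n (shapeWeight-long w (k + r) (i + j)) _
      (≡.subst (λ l → k + r < (i + j) + l) (≡.sym (length-replicate (r ∸ i)))
               (m<j⇒m+n<i+j+[n∸i] i≤r k<j))

  extendⁿ≈sBell : ∀ a b n k r i j → i ≤ r → j ≤ k →
    extendⁿ false n (shapeWeight (weight a b) (k + r) (i + j)) (specialSingletons (r ∸ i))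
      ≈ sBell R (r ∸ i) (n + (r ∸ i)) ((k ∸ j) + (r ∸ i)) a b
  extendⁿ≈sBell a b n k r i j i≤r j≤k =
    trans (reflexive (≡.cong (λ K → extendⁿ false n (shapeWeight (weight a b) K (i + j))
                                                    (specialSingletons (r ∸ i)))
                             (m+n≡i+j+[[m∸j]+[n∸i]] j≤k i≤r)))
          (sBell≈extendⁿ-shifted (r ∸ i) n (i + j) ((k ∸ j) + (r ∸ i)) a b)

proposition1 : {c ℓ : Level} (R : CommutativeRing c ℓ) →
    let open CommutativeRing R renaming (_+_ to _+R_) in
    (a b : ℕ → Carrier) (n k r : ℕ) →
    sBell R r (n + r) (k + r) a b
      ≈ sumTo R r (λ i → sumTo R k (λ j →
          fromℕ R (r C i) * fromℕ R (n C j) * pow R (b 1) i * pow R (a 1) j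
            * sBell R (r ∸ i) ((n ∸ j) + (r ∸ i)) ((k ∸ j) + (r ∸ i))
                (zeroFirst R a) (zeroFirst R b)))
proposition1 R a b n k r = begin
  sBell R r (n + r) (k + r) a b
    ≈⟨ sBell≈binomialSum a b n (k + r) r ⟩
  sumTo R n term
    ≈⟨ sumTo-vanishing n k (λ j n<j → nCk-vanishing n<j _ _) term-vanishing ⟩
  sumTo R k term
    ≈⟨ sumTo-cong k (λ j j≤k → trans (sym (sumTo-* r _ _)) (sumTo-cong r (λ i i≤r →
         trans (*-congˡ (*-congˡ (extendⁿ≈sBell a₀ b₀ (n ∸ j) k r i j i≤r j≤k)))
               (*-rearrange _ _ _ _ _)))) ⟩
  sumTo R k (λ j → sumTo R r (λ i → summand i j))
    ≈⟨ sumTo-comm r k summand ⟨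
  sumTo R r (λ i → sumTo R k (λ j → summand i j)) ∎
  where
  open CommutativeRing R using (Carrier; 0#; _*_; _≈_; setoid; trans; sym; *-congˡ; zeroʳ)
  open SetoidReasoning setoid
  open Sums R
  open ShapeSums R
  a₀ b₀ : ℕ → Carrier
  a₀ = zeroFirst R a
  b₀ = zeroFirst R b
  reduced : ℕ → ℕ → Carrier
  reduced i j =
    extendⁿ false (n ∸ j) (shapeWeight (weight a₀ b₀) (k + r) (i + j)) (specialSingletons (r ∸ i))
  term : ℕ → Carrier
  term j = fromℕ R (n C j) * pow R (a 1) j
         * sumTo R r (λ i → fromℕ R (r C i) * pow R (b 1) i * reduced i j)
  term-vanishing : ∀ j → k < j → term j ≈ 0#
  term-vanishing j k<j = trans (*-congˡ (sumTo-zero r (λ i i≤r →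
    trans (*-congˡ (extendⁿ-tooManyBlocks (weight a₀ b₀) (n ∸ j) k r i j i≤r k<j)) (zeroʳ _))))
    (zeroʳ _)
  summand : ℕ → ℕ → Carrier
  summand i j = fromℕ R (r C i) * fromℕ R (n C j) * pow R (b 1) i * pow R (a 1) j
              * sBell R (r ∸ i) ((n ∸ j) + (r ∸ i)) ((k ∸ j) + (r ∸ i)) a₀ b₀
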